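{- Let $r\ge 1$ and let $X$ be an $r$-ample simplicial complex. Then $X$ has at least $M'(r)+r\ge 2^{\binom{r}{\lfloor r/2\rfloor}}+r$ vertexes.
   Context: For a simplicial complex $X$ with vertex set $V(X)$ and $U\subseteq V(X)$, $X_U$ denotes the induced subcomplex on $U$. The link $\mathrm{Lk}_X(v)$ of a vertex $v$ is the subcomplex of simplexes $\sigma$ with $v\notin\sigma$ and $\sigma\cup\{v\}\in X$. A nonempty simplicial complex $X$ is $r$-ample if for every $U\subseteq V(X)$ with $|U|\le r$ and every subcomplex $A\subseteq X_U$ (possibly empty) there exists $v\in V(X)\setminus U$ with $\mathrm{Lk}_X(v)\cap X_U=A$. $M'(r)$ denotes the number of simplicial complexes (including the empty one) whose vertexes lie in the set $\{1,2,\dots,r\}$; e.g. $M'(1)=2$, $M'(2)=5$, $M'(3)=19$. -}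

module Defs where

open import Data.Nat using (ℕ; zero; suc; _+_; _≤_)
open import Data.Bool using (Bool; true; false; not; _∧_; _∨_)
open import Data.List using (List; []; _∷_; map; _++_; filter; length)
open import Data.Bool.ListAction using (all; any)
open import Data.Vec using (_∷_; [])
open import Data.Product using (_×_; Σ; ∃)
open import Data.Fin using (Fin)
open import Data.Fin.Subset using (Subset; ⊥; ⁅_⁆; _∪_; _⊆_; _∈_; _∉_; ∣_∣; Nonempty; inside; outside)
open import Data.Fin.Subset.Properties using (_⊆?_)
open import Data.Vec.Properties using (≡-dec)
import Data.Bool.Properties as BP
open import Relation.Nullary.Decidable using (⌊_⌋)
open import Function.Bundles using (_⇔_)
open import Relation.Binary.PropositionalEquality using (_≡_)

-- A simplex is a NONEMPTY subset of the vertex set (so that the empty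
-- complex and the complex consisting of one vertex are different,
-- matching M'(1) = 2).  V(X) = Fin n: every singleton is a face.

record SimplicialComplex (n : ℕ) : Set₁ where
  field
    face          : Subset n → Set
    face-nonempty : ∀ σ → face σ → Nonempty σ
    face-down     : ∀ σ τ → face σ → τ ⊆ σ → Nonempty τ → face τ
    vertex-face   : ∀ (v : Fin n) → face ⁅ v ⁆
open SimplicialComplex public

record SubcomplexOfInduced {n : ℕ} (X : SimplicialComplex n) (U : Subset n) : Set₁ where
  field
    sface          : Subset n → Set
    sface-nonempty : ∀ σ → sface σ → Nonempty σ
    sface-down     : ∀ σ τ → sface σ → τ ⊆ σ → Nonempty τ → sface τ
    sface-in-X     : ∀ σ → sface σ → face X σ
    sface-in-U     : ∀ σ → sface σ → σ ⊆ U
open SubcomplexOfInduced public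

InInduced : ∀ {n} → SimplicialComplex n → Subset n → Subset n → Set
InInduced X U σ = face X σ × σ ⊆ U

InLink : ∀ {n} → SimplicialComplex n → Fin n → Subset n → Set
InLink X v σ = v ∉ σ × face X (σ ∪ ⁅ v ⁆)

-- r-ample: X nonempty (n ≥ 1 is implied) and for every U with |U| ≤ r and
-- every subcomplex A ⊆ X_U there is v ∉ U with Lk_X(v) ∩ X_U = A.
Ample : ∀ {n} → ℕ → SimplicialComplex n → Set₁
Ample {n} r X =
  Fin n ×
  (∀ (U : Subset n) → ∣ U ∣ ≤ r → (A : SubcomplexOfInduced X U) →
     ∃ λ (v : Fin n) → v ∉ U ×
       (∀ σ → ((InLink X v σ × InInduced X U σ) ⇔ sface A σ)))

-- M'(r): the number of simplicial complexes (including the empty one)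
-- with vertexes in {1,…,r}, i.e. the number of families of nonempty
-- subsets of Fin r closed under taking nonempty subsets.

allSubsets : (r : ℕ) → List (Subset r)
allSubsets zero    = [] ∷ []
allSubsets (suc r) = map (outside ∷_) (allSubsets r) ++ map (inside ∷_) (allSubsets r)

sublists : ∀ {A : Set} → List A → List (List A)
sublists []       = [] ∷ []
sublists (x ∷ xs) = sublists xs ++ map (x ∷_) (sublists xs)

eqS : ∀ {r} → Subset r → Subset r → Bool
eqS σ τ = ⌊ ≡-dec BP._≟_ σ τ ⌋

memS : ∀ {r} → Subset r → List (Subset r) → Bool
memS σ fam = any (eqS σ) fam

isComplexB : ∀ {r} → List (Subset r) → Bool
isComplexB {r} fam =
  not (memS ⊥ fam) ∧
  all (λ σ → all (λ τ → not ⌊ τ ⊆? σ ⌋ ∨ eqS τ ⊥ ∨ memS τ fam) (allSubsets r)) fam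

M′ : ℕ → ℕ
M′ r = length (filter (λ fam → BP.T? (isComplexB fam)) (sublists (allSubsets r)))

-- A family of k-element subsets of {1,…,r} (k ≥ 1) generates, by
-- closing downwards, a simplicial complex whose maximal simplices are exactly the
-- members of the family; hence distinct families give distinct complexes and
-- M′(r) ≥ 2^C(r,k).  Take k = ⌊r/2⌋, or k = 1 when r = 1.
--
-- Applying r-ampleness with A = X_U itself produces a vertex whose
-- link contains X_U, so a full simplex on U can be coned off; repeating this gives
-- r vertices U spanning a full simplex of X.  Identifying U with {1,…,r}, every
-- complex A on {1,…,r} is a subcomplex of X_U, so ampleness provides a vertex
-- v_A ∉ U with Lk(v_A) ∩ X_U = A.  Since A is recovered from v_A, the M′(r)
-- vertices v_A are distinct, and together with U they give M′(r) + r vertices.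

module Submission where

open import Defs
open import Data.Nat using (ℕ; zero; suc; _+_; _≤_; _<_; _^_; _/_; z≤n; s≤s)
import Data.Nat as ℕ
open import Data.Nat.Properties
  using (module ≤-Reasoning; +-monoˡ-≤; +-identityʳ; +-comm; suc-injective; <-irrefl; ≤-trans; ≤-reflexive; ≤-refl; <⇒≤)
open import Data.Nat.Combinatorics using (_C_; nCk+nC[k+1]≡[n+1]C[k+1])
open import Data.Nat.DivMod using (m≥n⇒m/n>0)
open import Data.Bool using (Bool; true; false; T; not; _∨_)
open import Data.Bool.ListAction using (all)
open import Data.Bool.Properties using (T?; T-∧; T-∨; T-≡; T-not-≡; ¬-not) renaming (_≟_ to _≟ᵇ_)
open import Data.Fin using (Fin; zero; suc)
open import Data.Fin.Properties using (injective⇒≤) renaming (_≟_ to _≟ᶠ_; any? to anyᶠ?)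
open import Data.Fin.Subset using (Subset; _∈_; _∉_; _⊆_; _∪_; _∩_; ⁅_⁆; ∣_∣; outside; inside; ⊥; Nonempty)
open import Data.Fin.Subset.Properties
  using (_∈?_; _⊆?_; nonempty?; Empty-unique; ∉⊥; ∣⊥∣≡0; drop-∷-⊆; p⊆q⇒∣p∣≤∣q∣; ⊆-refl; ⊆-trans; ⊆-antisym;
         x∈p∪q⁺; x∈p∪q⁻; x∈p∩q⁺; p∩q⊆q; x∈⁅x⁆; x∈⁅y⁆⇒x≡y; ∪-identityʳ)
open import Data.List using (List; []; _∷_; map; _++_; filter; length; allFin)
import Data.List as List
open import Data.List.Properties using (length-++; length-map; length-tabulate; filter-++)
open import Data.List.Membership.Propositional using (find) renaming (_∈_ to _∈ˡ_)
open import Data.List.Membership.Propositional.Properties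
  using (∈-lookup; ∈-map⁺; ∈-map⁻; ∈-++⁺ˡ; ∈-++⁺ʳ; ∈-++⁻; ∈-filter⁺; ∈-filter⁻; ∈-tabulate⁻; ∈-allFin)
open import Data.List.Membership.Setoid.Properties using (index-injective)
open import Data.List.Relation.Unary.Any using (Any; here; there; any?)
import Data.List.Relation.Unary.Any as Any
open import Data.List.Relation.Unary.Any.Properties using (any⇔)
open import Data.List.Relation.Unary.All using (All)
import Data.List.Relation.Unary.All as All
import Data.List.Relation.Unary.All.Properties as AllP
open import Data.List.Relation.Unary.Unique.Propositional using (Unique; []; _∷_)
open import Data.List.Relation.Unary.Unique.Propositional.Properties using (++⁺; map⁺; filter⁺; tabulate⁺)
open import Data.Product using (_×_; _,_; ∃; proj₁; proj₂)
open import Data.Sum using (_⊎_; inj₁; inj₂)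
open import Data.Vec using ([]; _∷_; here; there; lookup; tabulate)
open import Data.Vec.Properties using (≡-dec; []=⇒lookup; lookup⇒[]=; lookup∘tabulate)
open import Function using (_∘_; case_of_)
open import Function.Bundles using (_⇔_; mk⇔; Equivalence)
open import Relation.Nullary using (¬_; yes; no; contradiction)
open import Relation.Nullary.Decidable using (⌊_⌋; fromWitness; toWitness; _×-dec_)
open import Relation.Unary using (Decidable)
open import Relation.Binary.PropositionalEquality

InjectiveOn : {A B : Set} → (A → B) → List A → Set
InjectiveOn f xs = ∀ {x y} → x ∈ˡ xs → y ∈ˡ xs → f x ≡ f y → x ≡ y

module _ {A : Set} where

  lookup-injective : {xs : List A} → Unique xs → ∀ {i j} → List.lookup xs i ≡ List.lookup xs j → i ≡ j
  lookup-injective (_ ∷ _)     {zero}  {zero}  _  = refl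
  lookup-injective (x∉xs ∷ _)  {zero}  {suc j} eq = contradiction eq (All.lookup x∉xs (∈-lookup j))
  lookup-injective (x∉xs ∷ _)  {suc i} {zero}  eq = contradiction (sym eq) (All.lookup x∉xs (∈-lookup i))
  lookup-injective (_ ∷ uxs)   {suc i} {suc j} eq = cong suc (lookup-injective uxs eq)

  Unique⇒length≤ : {xs ys : List A} → Unique xs → (∀ {x} → x ∈ˡ xs → x ∈ˡ ys) → length xs ≤ length ys
  Unique⇒length≤ {xs} uxs xs⊆ys = injective⇒≤ index∘lookup-injective
    where
    index∘lookup : Fin (length xs) → Fin _
    index∘lookup i = Any.index (xs⊆ys (∈-lookup i))
    index∘lookup-injective : ∀ {i j} → index∘lookup i ≡ index∘lookup j → i ≡ j
    index∘lookup-injective {i} {j} eq =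
      lookup-injective uxs (index-injective (setoid A) (xs⊆ys (∈-lookup i)) (xs⊆ys (∈-lookup j)) eq)

  Unique-map⁺-on : {B : Set} {f : A → B} {xs : List A} → InjectiveOn f xs → Unique xs → Unique (map f xs)
  Unique-map⁺-on {xs = []}    inj []          = []
  Unique-map⁺-on {xs = x ∷ _} inj (x∉xs ∷ uxs) =
    AllP.map⁺ (All.tabulate λ y∈xs fx≡fy → All.lookup x∉xs y∈xs (inj (here refl) (there y∈xs) fx≡fy))
    ∷ Unique-map⁺-on (λ p q → inj (there p) (there q)) uxs

  length-sublists : (xs : List A) → length (sublists xs) ≡ 2 ^ length xs
  length-sublists []       = refl
  length-sublists (x ∷ xs) = begin
    length (ys ++ map (x ∷_) ys)         ≡⟨ length-++ ys ⟩
    length ys + length (map (x ∷_) ys)   ≡⟨ cong (length ys +_) (length-map (x ∷_) ys) ⟩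
    length ys + length ys                ≡⟨ cong (λ m → m + m) (length-sublists xs) ⟩
    2 ^ length xs + 2 ^ length xs        ≡⟨ cong (2 ^ length xs +_) (+-identityʳ (2 ^ length xs)) ⟨
    2 ^ length (x ∷ xs)                  ∎
    where
    open ≡-Reasoning
    ys = sublists xs

  ∈-sublists⁻ : ∀ {x : A} {xs Y} → Y ∈ˡ sublists (x ∷ xs) →
                Y ∈ˡ sublists xs ⊎ ∃ λ Z → Z ∈ˡ sublists xs × Y ≡ x ∷ Z
  ∈-sublists⁻ {x} {xs} Y∈ with ∈-++⁻ (sublists xs) Y∈
  ... | inj₁ Y∈′ = inj₁ Y∈′
  ... | inj₂ Y∈′ = inj₂ (∈-map⁻ (x ∷_) Y∈′)

  ∈-sublists⇒⊆ : ∀ {xs Y} → Y ∈ˡ sublists xs → ∀ {z} → z ∈ˡ Y → z ∈ˡ xs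
  ∈-sublists⇒⊆ {[]}    (here refl) ()
  ∈-sublists⇒⊆ {x ∷ xs} Y∈ z∈Y with ∈-sublists⁻ {x} {xs} Y∈
  ... | inj₁ Y∈′                 = there (∈-sublists⇒⊆ Y∈′ z∈Y)
  ... | inj₂ (Z , Z∈ , refl) with z∈Y
  ...   | here z≡x  = here z≡x
  ...   | there z∈Z = there (∈-sublists⇒⊆ Z∈ z∈Z)

  filter∈sublists : ∀ {P : A → Set} (P? : Decidable P) xs → filter P? xs ∈ˡ sublists xs
  filter∈sublists P? []       = here refl
  filter∈sublists P? (x ∷ xs) with P? x
  ... | yes _ = ∈-++⁺ʳ (sublists xs) (∈-map⁺ (x ∷_) (filter∈sublists P? xs))
  ... | no _  = ∈-++⁺ˡ (filter∈sublists P? xs)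

  Unique-sublists : ∀ {xs} → Unique xs → Unique (sublists xs)
  Unique-sublists {[]}     _            = All.[] ∷ []
  Unique-sublists {x ∷ xs} (x∉xs ∷ uxs) =
    ++⁺ (Unique-sublists uxs) (map⁺ (λ { refl → refl }) (Unique-sublists uxs)) x∉
    where
    x∉ : ∀ {Y} → ¬ (Y ∈ˡ sublists xs × Y ∈ˡ map (x ∷_) (sublists xs))
    x∉ (Y∈ , xZ∈) with ∈-map⁻ (x ∷_) xZ∈
    ... | _ , _ , refl = contradiction (∈-sublists⇒⊆ Y∈ (here refl)) (AllP.All¬⇒¬Any x∉xs)

  sublists-extensional : ∀ {xs Y Y′} → Unique xs → Y ∈ˡ sublists xs → Y′ ∈ˡ sublists xs →
                         (∀ {z} → z ∈ˡ Y → z ∈ˡ Y′) → (∀ {z} → z ∈ˡ Y′ → z ∈ˡ Y) → Y ≡ Y′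
  sublists-extensional {[]} _ (here refl) (here refl) _ _ = refl
  sublists-extensional {x ∷ xs} (x∉xs ∷ uxs) Y∈ Y′∈ Y⊆Y′ Y′⊆Y
    with ∈-sublists⁻ {x} {xs} Y∈ | ∈-sublists⁻ {x} {xs} Y′∈
  ... | inj₁ Y∈′ | inj₁ Y′∈′ = sublists-extensional uxs Y∈′ Y′∈′ Y⊆Y′ Y′⊆Y
  ... | inj₁ Y∈′ | inj₂ (_ , _ , refl) =
    contradiction (∈-sublists⇒⊆ Y∈′ (Y′⊆Y (here refl))) (AllP.All¬⇒¬Any x∉xs)
  ... | inj₂ (_ , _ , refl) | inj₁ Y′∈′ =
    contradiction (∈-sublists⇒⊆ Y′∈′ (Y⊆Y′ (here refl))) (AllP.All¬⇒¬Any x∉xs)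
  ... | inj₂ (Z , Z∈ , refl) | inj₂ (Z′ , Z′∈ , refl) =
    cong (x ∷_) (sublists-extensional uxs Z∈ Z′∈ (drop-x Z∈ Y⊆Y′) (drop-x Z′∈ Y′⊆Y))
    where
    drop-x : ∀ {Z Z′} → Z ∈ˡ sublists xs → (∀ {z} → z ∈ˡ x ∷ Z → z ∈ˡ x ∷ Z′) → ∀ {z} → z ∈ˡ Z → z ∈ˡ Z′
    drop-x Z∈ ⊆′ z∈Z with ⊆′ (there z∈Z)
    ... | here refl  = contradiction (∈-sublists⇒⊆ Z∈ z∈Z) (AllP.All¬⇒¬Any x∉xs)
    ... | there z∈Z′ = z∈Z′

∈-allSubsets : ∀ {r} (σ : Subset r) → σ ∈ˡ allSubsets r
∈-allSubsets []              = here refl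
∈-allSubsets {suc r} (outside ∷ σ) = ∈-++⁺ˡ (∈-map⁺ (outside ∷_) (∈-allSubsets σ))
∈-allSubsets {suc r} (inside ∷ σ)  = ∈-++⁺ʳ (map (outside ∷_) (allSubsets r)) (∈-map⁺ (inside ∷_) (∈-allSubsets σ))

Unique-allSubsets : ∀ r → Unique (allSubsets r)
Unique-allSubsets zero    = All.[] ∷ []
Unique-allSubsets (suc r) =
  ++⁺ (map⁺ (λ { refl → refl }) (Unique-allSubsets r)) (map⁺ (λ { refl → refl }) (Unique-allSubsets r)) out≢in
  where
  out≢in : ∀ {σ} → ¬ (σ ∈ˡ map (outside ∷_) (allSubsets r) × σ ∈ˡ map (inside ∷_) (allSubsets r))
  out≢in (σ∈out , σ∈in) with ∈-map⁻ (outside ∷_) σ∈out | ∈-map⁻ (inside ∷_) σ∈in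
  ... | _ , _ , refl | _ , _ , ()

subsetsOfSize : (r k : ℕ) → List (Subset r)
subsetsOfSize r k = filter (λ σ → ∣ σ ∣ ℕ.≟ k) (allSubsets r)

ofSize : ∀ {r} → ℕ → List (Subset r) → ℕ
ofSize k xs = length (filter (λ σ → ∣ σ ∣ ℕ.≟ k) xs)

ofSize-outside : ∀ {r} k (xs : List (Subset r)) → ofSize k (map (outside ∷_) xs) ≡ ofSize k xs
ofSize-outside k []       = refl
ofSize-outside k (σ ∷ xs) with ∣ σ ∣ ℕ.≡ᵇ k
... | true  = cong suc (ofSize-outside k xs)
... | false = ofSize-outside k xs

ofSize-inside-zero : ∀ {r} (xs : List (Subset r)) → ofSize 0 (map (inside ∷_) xs) ≡ 0
ofSize-inside-zero []       = refl
ofSize-inside-zero (_ ∷ xs) = ofSize-inside-zero xs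

ofSize-inside-suc : ∀ {r} k (xs : List (Subset r)) → ofSize (suc k) (map (inside ∷_) xs) ≡ ofSize k xs
ofSize-inside-suc k []       = refl
ofSize-inside-suc k (σ ∷ xs) with ∣ σ ∣ ℕ.≡ᵇ k
... | true  = cong suc (ofSize-inside-suc k xs)
... | false = ofSize-inside-suc k xs

length-subsetsOfSize : ∀ r k → length (subsetsOfSize r k) ≡ r C k
length-subsetsOfSize zero    zero    = refl
length-subsetsOfSize zero    (suc k) = refl
length-subsetsOfSize (suc r) k = begin
  ofSize k (outs ++ ins)       ≡⟨ cong length (filter-++ (λ σ → ∣ σ ∣ ℕ.≟ k) outs ins) ⟩
  length (filter _ outs ++ filter _ ins) ≡⟨ length-++ (filter (λ σ → ∣ σ ∣ ℕ.≟ k) outs) ⟩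
  ofSize k outs + ofSize k ins ≡⟨ cong (_+ ofSize k ins) (ofSize-outside k (allSubsets r)) ⟩
  ofSize k (allSubsets r) + ofSize k ins ≡⟨ cong (_+ ofSize k ins) (length-subsetsOfSize r k) ⟩
  r C k + ofSize k ins         ≡⟨ pascal k ⟩
  suc r C k                    ∎
  where
  open ≡-Reasoning
  outs ins : List (Subset (suc r))
  outs = map (outside ∷_) (allSubsets r)
  ins  = map (inside ∷_) (allSubsets r)
  pascal : ∀ k → r C k + ofSize k ins ≡ suc r C k
  pascal zero    = cong (r C 0 +_) (ofSize-inside-zero (allSubsets r))
  pascal (suc k) = begin
    r C suc k + ofSize (suc k) ins ≡⟨ cong (r C suc k +_) (ofSize-inside-suc k (allSubsets r)) ⟩
    r C suc k + ofSize k (allSubsets r) ≡⟨ cong (r C suc k +_) (length-subsetsOfSize r k) ⟩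
    r C suc k + r C k              ≡⟨ +-comm (r C suc k) (r C k) ⟩
    r C k + r C suc k              ≡⟨ nCk+nC[k+1]≡[n+1]C[k+1] r k ⟩
    suc r C suc k                  ∎

p⊆q∧∣p∣≡∣q∣⇒p≡q : ∀ {r} {σ τ : Subset r} → σ ⊆ τ → ∣ σ ∣ ≡ ∣ τ ∣ → σ ≡ τ
p⊆q∧∣p∣≡∣q∣⇒p≡q {σ = []}            {[]}          _   _ = refl
p⊆q∧∣p∣≡∣q∣⇒p≡q {σ = inside  ∷ σ}  {inside  ∷ τ} σ⊆τ eq = cong (inside ∷_) (p⊆q∧∣p∣≡∣q∣⇒p≡q (drop-∷-⊆ σ⊆τ) (suc-injective eq))
p⊆q∧∣p∣≡∣q∣⇒p≡q {σ = outside ∷ σ}  {outside ∷ τ} σ⊆τ eq = cong (outside ∷_) (p⊆q∧∣p∣≡∣q∣⇒p≡q (drop-∷-⊆ σ⊆τ) eq)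
p⊆q∧∣p∣≡∣q∣⇒p≡q {σ = inside  ∷ σ}  {outside ∷ τ} σ⊆τ _  with σ⊆τ here
... | ()
p⊆q∧∣p∣≡∣q∣⇒p≡q {σ = outside ∷ σ}  {inside  ∷ τ} σ⊆τ eq =
  contradiction (≤-trans (s≤s (p⊆q⇒∣p∣≤∣q∣ (drop-∷-⊆ σ⊆τ))) (≤-reflexive (sym eq))) (<-irrefl refl)

∣p∪⁅x⁆∣≡1+∣p∣ : ∀ {n} (p : Subset n) {x} → x ∉ p → ∣ p ∪ ⁅ x ⁆ ∣ ≡ suc ∣ p ∣
∣p∪⁅x⁆∣≡1+∣p∣ (inside  ∷ p) {zero}  x∉p = contradiction here x∉p
∣p∪⁅x⁆∣≡1+∣p∣ (outside ∷ p) {zero}  x∉p = cong (suc ∘ ∣_∣) (∪-identityʳ p)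
∣p∪⁅x⁆∣≡1+∣p∣ (inside  ∷ p) {suc x} x∉p = cong suc (∣p∪⁅x⁆∣≡1+∣p∣ p (λ x∈p → x∉p (there x∈p)))
∣p∪⁅x⁆∣≡1+∣p∣ (outside ∷ p) {suc x} x∉p = ∣p∪⁅x⁆∣≡1+∣p∣ p (λ x∈p → x∉p (there x∈p))

∣p∣≡1+k⇒Nonempty : ∀ {r} {σ : Subset r} {k} → ∣ σ ∣ ≡ suc k → Nonempty σ
∣p∣≡1+k⇒Nonempty {r} {σ} ∣σ∣≡1+k with nonempty? σ
... | yes ne = ne
... | no ¬ne with () ← trans (sym ∣σ∣≡1+k) (trans (cong ∣_∣ (Empty-unique ¬ne)) (∣⊥∣≡0 r))

record IsComplex {r : ℕ} (fam : List (Subset r)) : Set where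
  field
    simplex-nonempty : ∀ {σ} → σ ∈ˡ fam → Nonempty σ
    simplex-down     : ∀ {σ τ} → σ ∈ˡ fam → τ ⊆ σ → Nonempty τ → τ ∈ˡ fam

module _ {r : ℕ} where

  T-eqS⇔≡ : ∀ {σ τ : Subset r} → T (eqS σ τ) ⇔ σ ≡ τ
  T-eqS⇔≡ {σ} {τ} = mk⇔ (toWitness {a? = ≡-dec _≟ᵇ_ σ τ}) fromWitness

  T-memS⇔∈ : ∀ {σ : Subset r} {fam} → T (memS σ fam) ⇔ σ ∈ˡ fam
  T-memS⇔∈ = mk⇔ (Any.map (Equivalence.to T-eqS⇔≡) ∘ Equivalence.from any⇔)
                  (Equivalence.to any⇔ ∘ Any.map (Equivalence.from T-eqS⇔≡))

  closedAt : List (Subset r) → Subset r → Subset r → Bool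
  closedAt fam σ τ = not ⌊ τ ⊆? σ ⌋ ∨ eqS τ ⊥ ∨ memS τ fam

  T-closedAt⇔ : ∀ {fam} {σ τ : Subset r} → T (closedAt fam σ τ) ⇔ (τ ⊆ σ → Nonempty τ → τ ∈ˡ fam)
  T-closedAt⇔ {fam} {σ} {τ} = mk⇔ to from
    where
    to : T (closedAt fam σ τ) → τ ⊆ σ → Nonempty τ → τ ∈ˡ fam
    to t τ⊆σ (x , x∈τ) with τ ⊆? σ
    ... | no τ⊈σ = contradiction (λ {x} → τ⊆σ {x}) τ⊈σ
    ... | yes _ with Equivalence.to (T-∨ {eqS τ ⊥}) t
    ...   | inj₁ τ≡⊥ = contradiction (subst (x ∈_) (Equivalence.to T-eqS⇔≡ τ≡⊥) x∈τ) ∉⊥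
    ...   | inj₂ τ∈  = Equivalence.to T-memS⇔∈ τ∈
    from : (τ ⊆ σ → Nonempty τ → τ ∈ˡ fam) → T (closedAt fam σ τ)
    from closed with τ ⊆? σ
    ... | no _    = _
    ... | yes τ⊆σ with nonempty? τ
    ...   | yes ne = Equivalence.from (T-∨ {eqS τ ⊥}) (inj₂ (Equivalence.from T-memS⇔∈ (closed τ⊆σ ne)))
    ...   | no ¬ne = Equivalence.from (T-∨ {eqS τ ⊥}) (inj₁ (Equivalence.from T-eqS⇔≡ (Empty-unique ¬ne)))

  T-isComplexB⇔IsComplex : ∀ {fam : List (Subset r)} → T (isComplexB fam) ⇔ IsComplex fam
  T-isComplexB⇔IsComplex {fam} = mk⇔ to from
    where
    closedAt-all : Subset r → Bool
    closedAt-all σ = all (closedAt fam σ) (allSubsets r)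
    to : T (isComplexB fam) → IsComplex fam
    to t = record { simplex-nonempty = nonempty ; simplex-down = down }
      where
      ⊥∉fam : T (not (memS ⊥ fam))
      ⊥∉fam = proj₁ (Equivalence.to T-∧ t)
      closed : All (T ∘ closedAt-all) fam
      closed = AllP.all⁺ closedAt-all fam (proj₂ (Equivalence.to (T-∧ {not (memS ⊥ fam)}) t))
      nonempty : ∀ {σ} → σ ∈ˡ fam → Nonempty σ
      nonempty {σ} σ∈ with nonempty? σ
      ... | yes ne = ne
      ... | no ¬ne = contradiction (subst T (Equivalence.to T-not-≡ ⊥∉fam)
                       (Equivalence.from T-memS⇔∈ (subst (_∈ˡ fam) (Empty-unique ¬ne) σ∈))) λ ()
      down : ∀ {σ τ} → σ ∈ˡ fam → τ ⊆ σ → Nonempty τ → τ ∈ˡ fam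
      down {σ} {τ} σ∈ = Equivalence.to T-closedAt⇔
        (All.lookup (AllP.all⁺ (closedAt fam σ) (allSubsets r) (All.lookup closed σ∈)) (∈-allSubsets τ))
    from : IsComplex fam → T (isComplexB fam)
    from c = Equivalence.from T-∧
      ( Equivalence.from T-not-≡ (¬-not λ memS≡true →
          ∉⊥ (proj₂ (simplex-nonempty (Equivalence.to T-memS⇔∈ (Equivalence.from T-≡ memS≡true)))))
      , AllP.all⁻ closedAt-all (All.tabulate λ {σ} σ∈ →
          AllP.all⁻ (closedAt fam σ) {allSubsets r} (All.tabulate λ {τ} _ →
            Equivalence.from (T-closedAt⇔ {fam} {σ} {τ}) (simplex-down σ∈))))
      where open IsComplex c

Complexes : (r : ℕ) → List (List (Subset r))
Complexes r = filter (λ fam → T? (isComplexB fam)) (sublists (allSubsets r))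

module _ {r : ℕ} where

  ∈-Complexes⁺ : ∀ {fam} → fam ∈ˡ sublists (allSubsets r) → IsComplex fam → fam ∈ˡ Complexes r
  ∈-Complexes⁺ fam∈ c = ∈-filter⁺ (λ fam → T? (isComplexB fam)) fam∈ (Equivalence.from T-isComplexB⇔IsComplex c)

  ∈-Complexes⁻ : ∀ {fam} → fam ∈ˡ Complexes r → fam ∈ˡ sublists (allSubsets r) × IsComplex fam
  ∈-Complexes⁻ fam∈ with ∈-filter⁻ (λ fam → T? (isComplexB fam)) {xs = sublists (allSubsets r)} fam∈
  ... | fam∈′ , c = fam∈′ , Equivalence.to T-isComplexB⇔IsComplex c

  Unique-Complexes : Unique (Complexes r)
  Unique-Complexes = filter⁺ _ (Unique-sublists (Unique-allSubsets r))

  Complexes-extensional : ∀ {fam fam′} → fam ∈ˡ Complexes r → fam′ ∈ˡ Complexes r →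
                          (∀ {σ} → σ ∈ˡ fam → σ ∈ˡ fam′) → (∀ {σ} → σ ∈ˡ fam′ → σ ∈ˡ fam) → fam ≡ fam′
  Complexes-extensional fam∈ fam′∈ =
    sublists-extensional (Unique-allSubsets r) (proj₁ (∈-Complexes⁻ fam∈)) (proj₁ (∈-Complexes⁻ fam′∈))

  -- Complexes generated by families of equal-size subsets

  generatedBy? : (Ts : List (Subset r)) → Decidable (λ σ → Nonempty σ × Any (σ ⊆_) Ts)
  generatedBy? Ts σ = nonempty? σ ×-dec any? (σ ⊆?_) Ts

  downClosure : List (Subset r) → List (Subset r)
  downClosure Ts = filter (generatedBy? Ts) (allSubsets r)

  ∈-downClosure⁺ : ∀ {Ts σ τ} → Nonempty σ → σ ⊆ τ → τ ∈ˡ Ts → σ ∈ˡ downClosure Ts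
  ∈-downClosure⁺ {Ts} {σ} ne σ⊆τ τ∈ =
    ∈-filter⁺ (generatedBy? Ts) (∈-allSubsets σ) (ne , Any.map (λ { refl {x} → σ⊆τ {x} }) τ∈)

  ∈-downClosure⁻ : ∀ {Ts σ} → σ ∈ˡ downClosure Ts → Nonempty σ × ∃ λ τ → τ ∈ˡ Ts × σ ⊆ τ
  ∈-downClosure⁻ {Ts} σ∈ with ∈-filter⁻ (generatedBy? Ts) {xs = allSubsets r} σ∈
  ... | _ , ne , σ⊆some = ne , find σ⊆some

  downClosure-isComplex : ∀ Ts → IsComplex (downClosure Ts)
  downClosure-isComplex Ts = record
    { simplex-nonempty = proj₁ ∘ ∈-downClosure⁻
    ; simplex-down     = λ σ∈ τ⊆σ ne → let _ , ρ , ρ∈ , σ⊆ρ = ∈-downClosure⁻ σ∈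
                                       in ∈-downClosure⁺ ne (⊆-trans τ⊆σ σ⊆ρ) ρ∈ }

  downClosure-injectiveOn : ∀ k → InjectiveOn downClosure (sublists (subsetsOfSize r (suc k)))
  downClosure-injectiveOn k Ts∈ Ts′∈ eq =
    sublists-extensional Unique-subsetsOfSize Ts∈ Ts′∈ (generators-determined Ts∈ Ts′∈ eq)
                                                       (generators-determined Ts′∈ Ts∈ (sym eq))
    where
    Unique-subsetsOfSize : Unique (subsetsOfSize r (suc k))
    Unique-subsetsOfSize = filter⁺ _ (Unique-allSubsets r)
    size : ∀ {Ts} → Ts ∈ˡ sublists (subsetsOfSize r (suc k)) → ∀ {σ} → σ ∈ˡ Ts → ∣ σ ∣ ≡ suc k
    size Ts∈ σ∈ = proj₂ (∈-filter⁻ (λ σ → ∣ σ ∣ ℕ.≟ suc k) {xs = allSubsets r} (∈-sublists⇒⊆ Ts∈ σ∈))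
    -- all generators have the same size, so each of them is maximal in the closure
    generators-determined : ∀ {Ts Ts′} → Ts ∈ˡ sublists (subsetsOfSize r (suc k)) →
      Ts′ ∈ˡ sublists (subsetsOfSize r (suc k)) → downClosure Ts ≡ downClosure Ts′ →
      ∀ {σ} → σ ∈ˡ Ts → σ ∈ˡ Ts′
    generators-determined Ts∈ Ts′∈ eq σ∈
      with ∈-downClosure⁻ (subst (_ ∈ˡ_) eq (∈-downClosure⁺ (∣p∣≡1+k⇒Nonempty (size Ts∈ σ∈)) ⊆-refl σ∈))
    ... | _ , ρ , ρ∈ , σ⊆ρ = subst (_∈ˡ _) (sym (p⊆q∧∣p∣≡∣q∣⇒p≡q σ⊆ρ (trans (size Ts∈ σ∈) (sym (size Ts′∈ ρ∈))))) ρ∈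

2^C≤M′ : ∀ r {k} → 1 ≤ k → 2 ^ (r C k) ≤ M′ r
2^C≤M′ r {suc k} _ = begin
  2 ^ (r C suc k)                           ≡⟨ cong (2 ^_) (length-subsetsOfSize r (suc k)) ⟨
  2 ^ length kSets                          ≡⟨ length-sublists kSets ⟨
  length (sublists kSets)                   ≡⟨ length-map downClosure (sublists kSets) ⟨
  length (map downClosure (sublists kSets)) ≤⟨ Unique⇒length≤ unique closure∈ ⟩
  length (Complexes r)                      ∎
  where
  open ≤-Reasoning
  kSets : List (Subset r)
  kSets = subsetsOfSize r (suc k)
  unique : Unique (map downClosure (sublists kSets))
  unique = Unique-map⁺-on (downClosure-injectiveOn k) (Unique-sublists (filter⁺ _ (Unique-allSubsets r)))
  closure∈ : ∀ {fam} → fam ∈ˡ map downClosure (sublists kSets) → fam ∈ˡ Complexes r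
  closure∈ fam∈ with ∈-map⁻ downClosure fam∈
  ... | Ts , _ , refl = ∈-Complexes⁺ (filter∈sublists _ (allSubsets r)) (downClosure-isComplex Ts)

∈⇔lookup≡inside : ∀ {n} {p : Subset n} {x} → x ∈ p ⇔ lookup p x ≡ inside
∈⇔lookup≡inside {p = p} {x} = mk⇔ []=⇒lookup (lookup⇒[]= x p)

∈-tabulate⇔ : ∀ {n} {f : Fin n → Bool} {x} → x ∈ tabulate f ⇔ f x ≡ inside
∈-tabulate⇔ {f = f} {x} = mk⇔
  (λ x∈ → trans (sym (lookup∘tabulate f x)) (Equivalence.to ∈⇔lookup≡inside x∈))
  (λ fx≡inside → Equivalence.from ∈⇔lookup≡inside (trans (lookup∘tabulate f x) fx≡inside))

module _ {m n : ℕ} (e : Fin m → Fin n) where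

  preimage : Subset n → Subset m
  preimage σ = tabulate (λ i → lookup σ (e i))

  image : Subset m → Subset n
  image ρ = tabulate λ x → ⌊ anyᶠ? (λ i → (e i ≟ᶠ x) ×-dec (i ∈? ρ)) ⌋

  ∈-preimage⇔ : ∀ {σ i} → i ∈ preimage σ ⇔ e i ∈ σ
  ∈-preimage⇔ = mk⇔ (Equivalence.from ∈⇔lookup≡inside ∘ Equivalence.to ∈-tabulate⇔)
                     (Equivalence.from ∈-tabulate⇔ ∘ Equivalence.to ∈⇔lookup≡inside)

  preimage-mono : ∀ {σ τ} → σ ⊆ τ → preimage σ ⊆ preimage τ
  preimage-mono σ⊆τ = Equivalence.from ∈-preimage⇔ ∘ σ⊆τ ∘ Equivalence.to ∈-preimage⇔

  ∈-image⇔ : ∀ {ρ x} → x ∈ image ρ ⇔ ∃ λ i → e i ≡ x × i ∈ ρ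
  ∈-image⇔ = mk⇔ (λ x∈ → toWitness (Equivalence.from T-≡ (Equivalence.to ∈-tabulate⇔ x∈)))
                  (λ witness → Equivalence.from ∈-tabulate⇔ (Equivalence.to T-≡ (fromWitness witness)))

  preimage-image : (∀ {i j} → e i ≡ e j → i ≡ j) → ∀ ρ → preimage (image ρ) ≡ ρ
  preimage-image e-injective ρ = ⊆-antisym
    (λ i∈ → case Equivalence.to ∈-image⇔ (Equivalence.to ∈-preimage⇔ i∈) of λ where
              (j , ej≡ei , j∈ρ) → subst (_∈ ρ) (e-injective ej≡ei) j∈ρ)
    (λ {i} i∈ρ → Equivalence.from ∈-preimage⇔ (Equivalence.from ∈-image⇔ (i , refl , i∈ρ)))

-- Full simplices in ample complexes

module _ {n : ℕ} (X : SimplicialComplex n) where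

  inducedSubcomplex : (U : Subset n) → SubcomplexOfInduced X U
  inducedSubcomplex U = record
    { sface          = InInduced X U
    ; sface-nonempty = λ σ σ∈ → face-nonempty X σ (proj₁ σ∈)
    ; sface-down     = λ σ τ (σ∈X , σ⊆U) τ⊆σ ne → face-down X σ τ σ∈X τ⊆σ ne , ⊆-trans τ⊆σ σ⊆U
    ; sface-in-X     = λ _ → proj₁
    ; sface-in-U     = λ _ → proj₂ }

  -- σ ⊆ (σ ∩ U) ∪ {v}, and the cone over σ ∩ U is a face because Lk(v) contains X_U
  cone-full : ∀ {U v} → (∀ σ → σ ⊆ U → Nonempty σ → face X σ) → (∀ σ → InInduced X U σ → InLink X v σ) →
              ∀ σ → σ ⊆ U ∪ ⁅ v ⁆ → Nonempty σ → face X σ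
  cone-full {U} {v} U-full Lk⊇X_U σ σ⊆U+v ne with nonempty? (σ ∩ U)
  ... | yes ne∩ = face-down X (σ ∩ U ∪ ⁅ v ⁆) σ
        (proj₂ (Lk⊇X_U (σ ∩ U) (U-full (σ ∩ U) (p∩q⊆q σ U) ne∩ , p∩q⊆q σ U))) σ⊆cone ne
    where
    σ⊆cone : σ ⊆ σ ∩ U ∪ ⁅ v ⁆
    σ⊆cone x∈σ with x∈p∪q⁻ U ⁅ v ⁆ (σ⊆U+v x∈σ)
    ... | inj₁ x∈U = x∈p∪q⁺ (inj₁ (x∈p∩q⁺ (x∈σ , x∈U)))
    ... | inj₂ x≡v = x∈p∪q⁺ (inj₂ x≡v)
  ... | no ¬ne∩ = face-down X ⁅ v ⁆ σ (vertex-face X v) σ⊆v ne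
    where
    σ⊆v : σ ⊆ ⁅ v ⁆
    σ⊆v {x} x∈σ with x∈p∪q⁻ U ⁅ v ⁆ (σ⊆U+v x∈σ)
    ... | inj₁ x∈U = contradiction (x , x∈p∩q⁺ (x∈σ , x∈U)) ¬ne∩
    ... | inj₂ x≡v = x≡v

  record FullSimplex (k : ℕ) : Set where
    field
      U                : Subset n
      ∣U∣≡k            : ∣ U ∣ ≡ k
      vertex           : Fin k → Fin n
      vertex-injective : ∀ {i j} → vertex i ≡ vertex j → i ≡ j
      vertex∈U         : ∀ i → vertex i ∈ U
      vertex-onto      : ∀ {x} → x ∈ U → ∃ λ i → vertex i ≡ x
      full             : ∀ σ → σ ⊆ U → Nonempty σ → face X σ

  emptySimplex : FullSimplex 0
  emptySimplex = record
    { U = ⊥ ; ∣U∣≡k = ∣⊥∣≡0 n ; vertex = λ () ; vertex-injective = λ { {()} } ; vertex∈U = λ ()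
    ; vertex-onto = λ x∈⊥ → contradiction x∈⊥ ∉⊥ ; full = λ σ σ⊆⊥ (_ , x∈σ) → contradiction (σ⊆⊥ x∈σ) ∉⊥ }

  coneSimplex : ∀ {k} (S : FullSimplex k) {v} → v ∉ FullSimplex.U S →
                (∀ σ → InInduced X (FullSimplex.U S) σ → InLink X v σ) → FullSimplex (suc k)
  coneSimplex {k} S {v} v∉U Lk⊇X_U = record
    { U                = U ∪ ⁅ v ⁆
    ; ∣U∣≡k            = trans (∣p∪⁅x⁆∣≡1+∣p∣ U v∉U) (cong suc ∣U∣≡k)
    ; vertex           = vertex′
    ; vertex-injective = vertex′-injective
    ; vertex∈U         = vertex′∈
    ; vertex-onto      = vertex′-onto
    ; full             = cone-full full Lk⊇X_U }
    where
    open FullSimplex S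
    vertex′ : Fin (suc k) → Fin n
    vertex′ zero    = v
    vertex′ (suc i) = vertex i
    vertex′-injective : ∀ {i j} → vertex′ i ≡ vertex′ j → i ≡ j
    vertex′-injective {zero}  {zero}  _  = refl
    vertex′-injective {zero}  {suc j} eq = contradiction (subst (_∈ U) (sym eq) (vertex∈U j)) v∉U
    vertex′-injective {suc i} {zero}  eq = contradiction (subst (_∈ U) eq (vertex∈U i)) v∉U
    vertex′-injective {suc i} {suc j} eq = cong suc (vertex-injective eq)
    vertex′∈ : ∀ i → vertex′ i ∈ U ∪ ⁅ v ⁆
    vertex′∈ zero    = x∈p∪q⁺ (inj₂ (x∈⁅x⁆ v))
    vertex′∈ (suc i) = x∈p∪q⁺ (inj₁ (vertex∈U i))
    vertex′-onto : ∀ {x} → x ∈ U ∪ ⁅ v ⁆ → ∃ λ i → vertex′ i ≡ x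
    vertex′-onto x∈ with x∈p∪q⁻ U ⁅ v ⁆ x∈
    ... | inj₁ x∈U = let i , vi≡x = vertex-onto x∈U in suc i , vi≡x
    ... | inj₂ x≡v = zero , sym (x∈⁅y⁆⇒x≡y v x≡v)

module _ {n r : ℕ} {X : SimplicialComplex n} (ample : Ample r X) where

  extendFullSimplex : ∀ {k} → k < r → FullSimplex X k → FullSimplex X (suc k)
  extendFullSimplex k<r S =
    let open FullSimplex S using (U; ∣U∣≡k)
        v , v∉U , Lk∩X_U⇔X_U = proj₂ ample U (≤-trans (≤-reflexive ∣U∣≡k) (<⇒≤ k<r)) (inducedSubcomplex X U)
    in coneSimplex X S v∉U (λ σ → proj₁ ∘ Equivalence.from (Lk∩X_U⇔X_U σ))

  fullSimplex : ∀ {k} → k ≤ r → FullSimplex X k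
  fullSimplex {zero}  _   = emptySimplex X
  fullSimplex {suc k} k<r = extendFullSimplex k<r (fullSimplex (<⇒≤ k<r))

  -- Every complex on Fin r is the trace of a link on a full r-simplex

  open FullSimplex (fullSimplex ≤-refl)

  Realised : List (Subset r) → Subset n → Set
  Realised fam σ = σ ⊆ U × Nonempty σ × preimage vertex σ ∈ˡ fam

  realise : (fam : List (Subset r)) → IsComplex fam → SubcomplexOfInduced X U
  realise fam c = record
    { sface          = Realised fam
    ; sface-nonempty = λ _ → proj₁ ∘ proj₂
    ; sface-down     = λ σ τ (σ⊆U , _ , σ∈) τ⊆σ ne@(x , x∈τ) →
        let i , vi≡x = vertex-onto (σ⊆U (τ⊆σ x∈τ))
        in ⊆-trans τ⊆σ σ⊆U , ne ,
           simplex-down σ∈ (preimage-mono vertex τ⊆σ)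
                           (i , Equivalence.from (∈-preimage⇔ vertex) (subst (_∈ τ) (sym vi≡x) x∈τ))
    ; sface-in-X     = λ σ (σ⊆U , ne , _) → full σ σ⊆U ne
    ; sface-in-U     = λ _ → proj₁ }
    where open IsComplex c

  image-realised : ∀ {fam ρ} → IsComplex fam → ρ ∈ˡ fam → Realised fam (image vertex ρ)
  image-realised {fam} {ρ} c ρ∈ =
    (λ x∈ → let j , vj≡x , _ = Equivalence.to (∈-image⇔ vertex) x∈ in subst (_∈ U) vj≡x (vertex∈U j)) ,
    (vertex i , Equivalence.from (∈-image⇔ vertex) (i , refl , i∈ρ)) ,
    subst (_∈ˡ fam) (sym (preimage-image vertex vertex-injective ρ)) ρ∈
    where
    i   = proj₁ (IsComplex.simplex-nonempty c ρ∈)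
    i∈ρ = proj₂ (IsComplex.simplex-nonempty c ρ∈)

  IsLinkVertex : List (Subset r) → Fin n → Set
  IsLinkVertex fam v = v ∉ U × (∀ σ → (InLink X v σ × InInduced X U σ) ⇔ Realised fam σ)

  linkVertexOf : ∀ fam → IsComplex fam → ∃ (IsLinkVertex fam)
  linkVertexOf fam c = proj₂ ample U (≤-reflexive ∣U∣≡k) (realise fam c)

  -- on lists that are not complexes the value is junk; it is never used
  linkVertex : List (Subset r) → Fin n
  linkVertex fam with T? (isComplexB fam)
  ... | yes c = proj₁ (linkVertexOf fam (Equivalence.to T-isComplexB⇔IsComplex c))
  ... | no _  = proj₁ ample

  linkVertex-spec : ∀ {fam} → IsComplex fam → IsLinkVertex fam (linkVertex fam)
  linkVertex-spec {fam} c with T? (isComplexB fam)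
  ... | yes c′ = proj₂ (linkVertexOf fam (Equivalence.to T-isComplexB⇔IsComplex c′))
  ... | no ¬c  = contradiction (Equivalence.from T-isComplexB⇔IsComplex c) ¬c

  linkVertex-determines : ∀ {fam fam′} → IsComplex fam → IsComplex fam′ → linkVertex fam ≡ linkVertex fam′ →
                          ∀ {ρ} → ρ ∈ˡ fam → ρ ∈ˡ fam′
  linkVertex-determines {fam} {fam′} c c′ eq {ρ} ρ∈ =
    let inLink , inInduced = Equivalence.from (proj₂ (linkVertex-spec c) (image vertex ρ)) (image-realised c ρ∈)
        _ , _ , preimage∈fam′ = Equivalence.to (proj₂ (linkVertex-spec c′) (image vertex ρ))
                                  (subst (λ v → InLink X v (image vertex ρ)) eq inLink , inInduced)
    in subst (_∈ˡ fam′) (preimage-image vertex vertex-injective ρ) preimage∈fam′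

  linkVertex-injectiveOn : InjectiveOn linkVertex (Complexes r)
  linkVertex-injectiveOn fam∈ fam′∈ eq =
    Complexes-extensional fam∈ fam′∈ (linkVertex-determines c c′ eq) (linkVertex-determines c′ c (sym eq))
    where
    c  = proj₂ (∈-Complexes⁻ fam∈)
    c′ = proj₂ (∈-Complexes⁻ fam′∈)

  M′+r≤n : M′ r + r ≤ n
  M′+r≤n = begin
    M′ r + r                               ≡⟨ cong₂ _+_ (length-map linkVertex (Complexes r)) (length-tabulate vertex) ⟨
    length links + length simplexVertices  ≡⟨ length-++ links ⟨
    length (links ++ simplexVertices)      ≤⟨ Unique⇒length≤ unique (λ {x} _ → ∈-allFin x) ⟩
    length (allFin n)                      ≡⟨ length-tabulate (λ x → x) ⟩
    n                                      ∎
    where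
    open ≤-Reasoning
    links simplexVertices : List (Fin n)
    links           = map linkVertex (Complexes r)
    simplexVertices = List.tabulate vertex
    links∉U : ∀ {x} → x ∈ˡ links → x ∉ U
    links∉U x∈ with ∈-map⁻ linkVertex x∈
    ... | fam , fam∈ , refl = proj₁ (linkVertex-spec (proj₂ (∈-Complexes⁻ fam∈)))
    unique : Unique (links ++ simplexVertices)
    unique = ++⁺ (Unique-map⁺-on linkVertex-injectiveOn Unique-Complexes) (tabulate⁺ vertex-injective)
      λ (x∈links , x∈U) → let i , x≡vi = ∈-tabulate⁻ x∈U in
        contradiction (subst (_∈ U) (sym x≡vi) (vertex∈U i)) (links∉U x∈links)

2^C[r,r/2]≤M′ : ∀ r → 1 ≤ r → 2 ^ (r C (r / 2)) ≤ M′ r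
2^C[r,r/2]≤M′ 1                 _ = 2^C≤M′ 1 {1} ≤-refl   -- 1 / 2 = 0, but C(1,0) = C(1,1)
2^C[r,r/2]≤M′ r@(suc (suc _)) _ = 2^C≤M′ r (m≥n⇒m/n>0 {r} {2} (s≤s (s≤s z≤n)))

corollary2p6 : (r : ℕ) → 1 ≤ r → (n : ℕ) → (X : SimplicialComplex n) → Ample r X →
    (2 ^ (r C (r / 2)) + r ≤ M′ r + r) × (M′ r + r ≤ n)
corollary2p6 r 1≤r n X ample = +-monoˡ-≤ r (2^C[r,r/2]≤M′ r 1≤r) , M′+r≤n ample
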